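{- Union-closed multirelations form a category whose objects are sets, whose morphisms from $X$ to $Y$ are union-closed relations $X\rightharpoonup\wp(Y)$, whose composition is Peleg composition $*$, and whose identity on each set $X$ is the singleton map $1_X$.
   Context: Relations $\alpha:X\rightharpoonup Y$ are subsets of $X\times Y$. Composition is juxtaposition; $\sqsubseteq$ is inclusion, $\sqcup$ union; $\mathrm{dom}\,\alpha=\{(x,x)\mid\exists y.\,(x,y)\in\alpha\}$; a pfn is a univalent relation. $\ni_W:\wp(W)\rightharpoonup W$ is membership, $(A,w)\in\ni_W$ iff $w\in A$. For $\rho:Z\rightharpoonup W$, $\rho^@:Z\to\wp(W)$ is $z\mapsto\{w\mid(z,w)\in\rho\}$. The singleton map $1_X:X\to\wp(X)$ is $x\mapsto\{x\}$. For $f:Y\rightharpoonup\wp(Z)$, $(B,A)\in f_\circ$ iff $A=\bigcup\{C\mid\exists b\in B.\,(b,C)\in f\}$. For $v\sqsubseteq\mathrm{id}_Y$, $\hat u_v=\{(A,A)\mid A\subseteq Y,\ \forall a\in A.\,(a,a)\in v\}$. $f\sqsubseteq_c\beta$ means $f\sqsubseteq\beta$, $f$ a pfn, $\mathrm{dom}\,f=\mathrm{dom}\,\beta$. Peleg lifting: $\beta_*=\bigsqcup_{f\sqsubseteq_c\beta}\hat u_{\mathrm{dom}\,\beta}f_\circ$ (i.e. $(B,A)\in\beta_*$ iff there is a function $f$ on $B$ with $(b,f(b))\in\beta$ for all $b\in B$ and $A=\bigcup_{b\in B}f(b)$); Peleg composition $\alpha*\beta=\alpha\beta_*$. A relation $\gamma:Z\rightharpoonup\wp(W)$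 is union-closed if $\mathrm{dom}\,\rho\,(\rho\ni_W)^@\sqsubseteq\gamma$ for all $\rho\sqsubseteq\gamma$; equivalently, for each $a\in Z$, every nonempty family $\mathcal B\subseteq\{B\mid(a,B)\in\gamma\}$ satisfies $(a,\bigcup\mathcal B)\in\gamma$. -}

module Defs where

open import Level using (Lift)
open import Data.Product using (Σ; Σ-syntax; ∃; _×_; _,_)
open import Function.Bundles using (_⇔_)
open import Relation.Binary.PropositionalEquality using (_≡_)

℘ : Set → Set₁
℘ Y = Y → Set

_≐_ : {Y : Set} → ℘ Y → ℘ Y → Set
A ≐ B = ∀ y → A y ⇔ B y

MRel : Set → Set → Set₂
MRel X Y = X → ℘ Y → Set₁

_≈_ : {X Y : Set} → MRel X Y → MRel X Y → Set₁
α ≈ β = ∀ x A → α x A ⇔ β x A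

-- A multirelation is a subset of X × ℘(Y): membership respects
-- extensional equality of the subset component.
Extensional : {X Y : Set} → MRel X Y → Set₁
Extensional {X} {Y} γ = ∀ (x : X) (A A' : ℘ Y) → A ≐ A' → γ x A → γ x A'

-- Union-closed: for every a, every nonempty family (indexed by a set I)
-- of B with (a,B) ∈ γ has its union in γ.
UnionClosed : {X Y : Set} → MRel X Y → Set₁
UnionClosed {X} {Y} γ =
  ∀ (a : X) (I : Set) (ℬ : I → ℘ Y) → I → (∀ i → γ a (ℬ i)) →
  γ a (λ y → Σ[ i ∈ I ] ℬ i y)

IsUCMorphism : {X Y : Set} → MRel X Y → Set₁
IsUCMorphism γ = Extensional γ × UnionClosed γ

one : (X : Set) → MRel X X
one X x A = Lift _ (A ≐ (λ y → x ≡ y))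

lift* : {Y Z : Set} → MRel Y Z → ℘ Y → ℘ Z → Set₁
lift* {Y} {Z} β B A =
  Σ[ f ∈ (Y → ℘ Z) ] ((∀ b → B b → β b (f b)) × (A ≐ (λ z → Σ[ b ∈ Y ] (B b × f b z))))

_⊛_ : {X Y Z : Set} → MRel X Y → MRel Y Z → MRel X Z
_⊛_ {X} {Y} α β x C = Σ[ B ∈ ℘ Y ] (α x B × lift* β B C)

-- The Peleg lifting β_* of a union-closed β is itself closed under arbitrary unions: lifting each
-- member of a family and collecting, at every point b, the images chosen for b into one union
-- (which β contains since β is union-closed) lifts the union of the family. This gives closure of
-- α * β under unions, and it lets a lifting of β * γ be split into a lifting of β followed by one
-- of γ, which is the non-trivial half of associativity. The unit laws hold because the lifting of
-- 1_Y is extensional equality of subsets and the lifting of α at {x} is α at x.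
module Submission where

open import Defs
open import Level using (0ℓ; lift; lower)
open import Data.Product using (Σ-syntax; _×_; _,_; proj₁; proj₂)
open import Function.Bundles using (mk⇔; Equivalence)
open import Function.Properties.Equivalence using (⇔-isEquivalence)
open import Relation.Binary.Structures using (IsEquivalence)
open import Relation.Binary.PropositionalEquality using (_≡_; refl; sym; subst)

open Equivalence using (to; from)
open IsEquivalence (⇔-isEquivalence {ℓ = 0ℓ})
  using () renaming (refl to ⇔-refl; sym to ⇔-sym; trans to ⇔-trans)

private
  variable
    W X Y Z : Set

⋃ : {I : Set} → (I → ℘ Y) → ℘ Y
⋃ {I = I} ℬ y = Σ[ i ∈ I ] ℬ i y

≐-refl : {A : ℘ Y} → A ≐ A
≐-refl y = ⇔-refl

≐-sym : {A B : ℘ Y} → A ≐ B → B ≐ A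
≐-sym e y = ⇔-sym (e y)

≐-trans : {A B C : ℘ Y} → A ≐ B → B ≐ C → A ≐ C
≐-trans e e' y = ⇔-trans (e y) (e' y)

_⊑_ : MRel X Y → MRel X Y → Set₁
α ⊑ β = ∀ x A → α x A → β x A

⊑-antisym : {α β : MRel X Y} → α ⊑ β → β ⊑ α → α ≈ β
⊑-antisym α⊑β β⊑α x A = mk⇔ (α⊑β x A) (β⊑α x A)

≈⇒⊑ : {α β : MRel X Y} → α ≈ β → α ⊑ β
≈⇒⊑ α≈β x A = to (α≈β x A)

≈⇒⊒ : {α β : MRel X Y} → α ≈ β → β ⊑ α
≈⇒⊒ α≈β x A = from (α≈β x A)

one-extensional : Extensional (one X)
one-extensional x A A' A≐A' (lift A≐x) = lift (≐-trans (≐-sym A≐A') A≐x)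

one-unionClosed : UnionClosed (one X)
one-unionClosed x I ℬ i ℬ≐x = lift λ y →
  mk⇔ (λ (j , y∈ℬj) → to (lower (ℬ≐x j) y) y∈ℬj)
      (λ x≡y → i , from (lower (ℬ≐x i) y) x≡y)

lift*-resp-≐ : {β : MRel Y Z} {B : ℘ Y} {A A' : ℘ Z} →
               A ≐ A' → lift* β B A → lift* β B A'
lift*-resp-≐ A≐A' (f , βf , A≐⋃f) = f , βf , ≐-trans (≐-sym A≐A') A≐⋃f

lift*-mono : {β β' : MRel Y Z} {B : ℘ Y} {A : ℘ Z} →
             β ⊑ β' → lift* β B A → lift* β' B A
lift*-mono β⊑β' (f , βf , A≐⋃f) = f , (λ b b∈B → β⊑β' b (f b) (βf b b∈B)) , A≐⋃f

lift*-⋃ : {β : MRel Y Z} → UnionClosed β → {I : Set} {ℬ : I → ℘ Y} {𝒜 : I → ℘ Z} →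
          (∀ i → lift* β (ℬ i) (𝒜 i)) → lift* β (⋃ ℬ) (⋃ 𝒜)
lift*-⋃ {Y = Y} {Z = Z} {β = β} ucβ {I} {ℬ} {𝒜} lifts = f , βf , ⋃𝒜≐⋃f
  where
  fᵢ : I → Y → ℘ Z
  fᵢ i = proj₁ (lifts i)

  𝒜ᵢ≐⋃fᵢ : ∀ i → 𝒜 i ≐ (λ z → Σ[ b ∈ Y ] (ℬ i b × fᵢ i b z))
  𝒜ᵢ≐⋃fᵢ i = proj₂ (proj₂ (lifts i))

  f : Y → ℘ Z
  f b = ⋃ {I = Σ[ i ∈ I ] ℬ i b} (λ (i , _) → fᵢ i b)

  βf : ∀ b → ⋃ ℬ b → β b (f b)
  βf b b∈⋃ℬ =
    ucβ b _ _ b∈⋃ℬ (λ (i , b∈ℬᵢ) → proj₁ (proj₂ (lifts i)) b b∈ℬᵢ)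

  ⋃𝒜≐⋃f : ⋃ 𝒜 ≐ (λ z → Σ[ b ∈ Y ] (⋃ ℬ b × f b z))
  ⋃𝒜≐⋃f z = mk⇔
    (λ (i , z∈𝒜ᵢ) → let (b , b∈ℬᵢ , z∈fᵢb) = to (𝒜ᵢ≐⋃fᵢ i z) z∈𝒜ᵢ
                     in b , (i , b∈ℬᵢ) , ((i , b∈ℬᵢ) , z∈fᵢb))
    (λ (b , _ , ((i , b∈ℬᵢ) , z∈fᵢb)) →
       i , from (𝒜ᵢ≐⋃fᵢ i z) (b , b∈ℬᵢ , z∈fᵢb))

lift*-singleton : {α : MRel X Y} {x : X} {C : ℘ Y} → α x C → lift* α (x ≡_) C
lift*-singleton {C = C} αxC =
  (λ _ → C) , (λ { _ refl → αxC }) ,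
  λ z → mk⇔ (λ z∈C → _ , refl , z∈C) (λ (_ , _ , z∈C) → z∈C)

lift*-at-singleton : {α : MRel X Y} {x : X} {B : ℘ X} {C : ℘ Y} → Extensional α →
                     B ≐ (x ≡_) → lift* α B C → α x C
lift*-at-singleton {x = x} {B = B} {C = C} extα B≐x (f , αf , C≐⋃f) =
  extα x (f x) C (≐-sym C≐fx) (αf x x∈B)
  where
  x∈B : B x
  x∈B = from (B≐x x) refl

  C≐fx : C ≐ f x
  C≐fx z = mk⇔
    (λ z∈C → let (b , b∈B , z∈fb) = to (C≐⋃f z) z∈C
             in subst (λ b → f b z) (sym (to (B≐x b) b∈B)) z∈fb)
    (λ z∈fx → from (C≐⋃f z) (x , x∈B , z∈fx))

lift*-one-refl : {B : ℘ Y} → lift* (one Y) B B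
lift*-one-refl {B = B} =
  _≡_ , (λ _ _ → lift ≐-refl) ,
  λ z → mk⇔ (λ z∈B → z , z∈B , refl) (λ (_ , b∈B , b≡z) → subst B b≡z b∈B)

lift*-one⇒≐ : {B C : ℘ Y} → lift* (one Y) B C → B ≐ C
lift*-one⇒≐ {B = B} (f , f≐η , C≐⋃f) z = mk⇔
  (λ z∈B → from (C≐⋃f z) (z , z∈B , from (lower (f≐η z z∈B) z) refl))
  (λ z∈C → let (b , b∈B , z∈fb) = to (C≐⋃f z) z∈C
           in subst B (to (lower (f≐η b b∈B) z) z∈fb) b∈B)

lift*-⊛⁺ : {β : MRel X Y} {γ : MRel Y Z} {B : ℘ X} {C : ℘ Y} {D : ℘ Z} →
           lift* β B C → lift* γ C D → lift* (β ⊛ γ) B D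
lift*-⊛⁺ {X = X} {Y = Y} {Z = Z} {β = β} {γ = γ} {B = B} {C = C} {D = D}
         (f , βf , C≐⋃f) (g , γg , D≐⋃g) = h , βγh , D≐⋃h
  where
  h : X → ℘ Z
  h b z = Σ[ c ∈ Y ] (f b c × g c z)

  βγh : ∀ b → B b → (β ⊛ γ) b (h b)
  βγh b b∈B =
    f b , βf b b∈B , g , (λ c c∈fb → γg c (from (C≐⋃f c) (b , b∈B , c∈fb))) , ≐-refl

  D≐⋃h : D ≐ (λ z → Σ[ b ∈ X ] (B b × h b z))
  D≐⋃h z = mk⇔
    (λ z∈D → let (c , c∈C , z∈gc) = to (D≐⋃g z) z∈D
                 (b , b∈B , c∈fb) = to (C≐⋃f c) c∈C
             in b , b∈B , c , c∈fb , z∈gc)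
    (λ (b , b∈B , c , c∈fb , z∈gc) →
       from (D≐⋃g z) (c , from (C≐⋃f c) (b , b∈B , c∈fb) , z∈gc))

-- The intermediate set C is the union of all the sets chosen by β for the points of B.
lift*-⊛⁻ : {β : MRel X Y} {γ : MRel Y Z} {B : ℘ X} {D : ℘ Z} →
           UnionClosed β → UnionClosed γ →
           lift* (β ⊛ γ) B D → Σ[ C ∈ ℘ Y ] (lift* β B C × lift* γ C D)
lift*-⊛⁻ {X = X} {Y = Y} {β = β} {γ = γ} {B = B} {D = D} ucβ ucγ (h , βγh , D≐⋃h) =
  C , lift-β , lift-γ
  where
  Cᵢ : Σ[ b ∈ X ] B b → ℘ Y
  Cᵢ (b , b∈B) = proj₁ (βγh b b∈B)

  C : ℘ Y
  C = ⋃ Cᵢ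

  lift-β : lift* β B C
  lift-β =
    (λ b → ⋃ {I = B b} (λ b∈B → Cᵢ (b , b∈B))) ,
    (λ b b∈B → ucβ b (B b) _ b∈B (λ b∈B' → proj₁ (proj₂ (βγh b b∈B')))) ,
    λ y → mk⇔ (λ ((b , b∈B) , y∈Cᵢ) → b , b∈B , b∈B , y∈Cᵢ)
              (λ (b , _ , b∈B , y∈Cᵢ) → (b , b∈B) , y∈Cᵢ)

  D≐⋃hᵢ : D ≐ ⋃ (λ ((b , _) : Σ[ b ∈ X ] B b) → h b)
  D≐⋃hᵢ z = ⇔-trans (D≐⋃h z) (mk⇔ (λ (b , b∈B , z∈hb) → (b , b∈B) , z∈hb)
                                   (λ ((b , b∈B) , z∈hb) → b , b∈B , z∈hb))

  lift-γ : lift* γ C D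
  lift-γ = lift*-resp-≐ {β = γ} (≐-sym D≐⋃hᵢ)
             (lift*-⋃ {β = γ} ucγ (λ (b , b∈B) → proj₂ (proj₂ (βγh b b∈B))))

⊛-extensional : {α : MRel X Y} {β : MRel Y Z} → Extensional (α ⊛ β)
⊛-extensional {β = β} x A A' A≐A' (B , αxB , B↦A) =
  B , αxB , lift*-resp-≐ {β = β} A≐A' B↦A

⊛-unionClosed : {α : MRel X Y} {β : MRel Y Z} →
                UnionClosed α → UnionClosed β → UnionClosed (α ⊛ β)
⊛-unionClosed {β = β} ucα ucβ x I 𝒜 i x↦𝒜 =
  ⋃ (λ j → proj₁ (x↦𝒜 j)) ,
  ucα x I _ i (λ j → proj₁ (proj₂ (x↦𝒜 j))) ,
  lift*-⋃ {β = β} ucβ (λ j → proj₂ (proj₂ (x↦𝒜 j)))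

⊛-mono : {α α' : MRel X Y} {β β' : MRel Y Z} →
         α ⊑ α' → β ⊑ β' → (α ⊛ β) ⊑ (α' ⊛ β')
⊛-mono α⊑α' β⊑β' x C (B , αxB , B↦C) = B , α⊑α' x B αxB , lift*-mono β⊑β' B↦C

⊛-cong : {α α' : MRel X Y} {β β' : MRel Y Z} →
         α ≈ α' → β ≈ β' → (α ⊛ β) ≈ (α' ⊛ β')
⊛-cong α≈α' β≈β' =
  ⊑-antisym (⊛-mono (≈⇒⊑ α≈α') (≈⇒⊑ β≈β')) (⊛-mono (≈⇒⊒ α≈α') (≈⇒⊒ β≈β'))

⊛-identityˡ : {α : MRel X Y} → Extensional α → (one X ⊛ α) ≈ α
⊛-identityˡ extα = ⊑-antisym
  (λ x C (B , lift B≐x , B↦C) → lift*-at-singleton extα B≐x B↦C)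
  (λ x C αxC → (x ≡_) , lift ≐-refl , lift*-singleton αxC)

⊛-identityʳ : {α : MRel X Y} → Extensional α → (α ⊛ one Y) ≈ α
⊛-identityʳ extα = ⊑-antisym
  (λ x C (B , αxB , B↦C) → extα x B C (lift*-one⇒≐ B↦C) αxB)
  (λ x C αxC → C , αxC , lift*-one-refl)

⊛-assoc : {α : MRel W X} {β : MRel X Y} {γ : MRel Y Z} →
          UnionClosed β → UnionClosed γ →
          ((α ⊛ β) ⊛ γ) ≈ (α ⊛ (β ⊛ γ))
⊛-assoc {β = β} {γ = γ} ucβ ucγ = ⊑-antisym
  (λ w D (C , (B , αwB , B↦C) , C↦D) → B , αwB , lift*-⊛⁺ {β = β} {γ = γ} B↦C C↦D)
  (λ w D (B , αwB , B↦D) → let (C , B↦C , C↦D) = lift*-⊛⁻ {β = β} {γ = γ} ucβ ucγ B↦D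
                           in C , (B , αwB , B↦C) , C↦D)

proposition8p4 : (∀ {X : Set} → IsUCMorphism (one X))
    × (∀ {X Y Z : Set} {α : MRel X Y} {β : MRel Y Z} → IsUCMorphism α → IsUCMorphism β → IsUCMorphism (α ⊛ β))
    × (∀ {X Y Z : Set} {α α' : MRel X Y} {β β' : MRel Y Z} → IsUCMorphism α → IsUCMorphism α' → IsUCMorphism β → IsUCMorphism β' → α ≈ α' → β ≈ β' → (α ⊛ β) ≈ (α' ⊛ β'))
    × (∀ {X Y : Set} {α : MRel X Y} → IsUCMorphism α → ((one X ⊛ α) ≈ α) × ((α ⊛ one Y) ≈ α))
    × (∀ {W X Y Z : Set} {α : MRel W X} {β : MRel X Y} {γ : MRel Y Z} → IsUCMorphism α → IsUCMorphism β → IsUCMorphism γ → ((α ⊛ β) ⊛ γ) ≈ (α ⊛ (β ⊛ γ)))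
proposition8p4 =
  (one-extensional , one-unionClosed) ,
  (λ {α = α} {β} (_ , ucα) (_ , ucβ) →
     ⊛-extensional {α = α} {β} , ⊛-unionClosed {α = α} {β} ucα ucβ) ,
  (λ _ _ _ _ → ⊛-cong) ,
  (λ (extα , _) → ⊛-identityˡ extα , ⊛-identityʳ extα) ,
  (λ {α = α} {β} {γ} _ (_ , ucβ) (_ , ucγ) → ⊛-assoc {α = α} {β} {γ} ucβ ucγ)
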